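{- Let $p$ be an odd prime, let $a$ be a positive integer, and let $m$ be an integer not divisible by $p$. Then $$\sum_{k=0}^{(p^a-1)/2}\frac{\binom{2k}{k+1}}{m^k}\equiv\frac{m-2}{2}\sum_{k=0}^{(p^a-1)/2}\frac{\binom{2k}{k}}{m^k}-\frac m2+2p\,\delta_{a,1}\left(\frac{ -m}{p}\right)\pmod{p^2}.$$
   Context: $\left(\frac{\cdot}{p}\right)$ is the Legendre symbol and $\delta_{a,1}$ is the Kronecker delta. Congruences between rational numbers whose denominators are prime to $p$ are understood in the ring of rationals with denominator prime to $p$. -}

module Defs where

open import Data.Nat as ℕ using (ℕ; zero; suc)
open import Data.Nat.Coprimality using (Coprime)
open import Data.Integer as ℤ using (ℤ; +_; -[1+_])
open import Data.Integer.DivMod using (_%ℕ_)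
open import Data.Integer.Divisibility using () renaming (_∣_ to _∣ℤ_)
open import Data.Rational as ℚ using (ℚ; 0ℚ; _/_; ↥_; ↧ₙ_)
open import Data.Fin using (Fin; toℕ)
open import Data.Fin.Properties using (any?)
open import Data.List using (List; foldr; map; upTo)
open import Data.Product using (_×_)
open import Relation.Nullary.Decidable using (does)
open import Data.Bool using (if_then_else_)
open import Relation.Binary.PropositionalEquality using (_≡_)

ℤ→ℚ : ℤ → ℚ
ℤ→ℚ z = z / 1

-- exact reciprocal 1/z of a nonzero integer z (value at 0 is irrelevant: 0)
recipℤ : ℤ → ℚ
recipℤ (+ zero)    = 0ℚ
recipℤ (+ suc n)   = + 1 / suc n
recipℤ (-[1+ n ])  = -[1+ 0 ] / suc n

Σ[0…_] : ℕ → (ℕ → ℚ) → ℚ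
Σ[0… N ] f = foldr ℚ._+_ 0ℚ (map f (upTo (suc N)))

δ : ℕ → ℕ → ℤ
δ a b = if does (a ℕ.≟ b) then + 1 else + 0

legendre : ℤ → (p : ℕ) → ℤ
legendre x zero = + 0
legendre x (suc q) with x %ℕ suc q
... | zero = + 0
... | suc r =
  if does (any? {n = suc q} (λ (y : Fin (suc q)) →
        ((toℕ y ℕ.* toℕ y) ℕ.% suc q) ℕ.≟ suc r))
  then + 1 else -[1+ 0 ]

-- congruence x ≡ y (mod n) in the ring of rationals with denominator prime to n:
-- writing x - y in lowest terms, its denominator is coprime to n and n divides its numerator
_≡_[modℚ_] : ℚ → ℚ → ℕ → Set
x ≡ y [modℚ n ] = Coprime (↧ₙ (x ℚ.- y)) n × ((+ n) ∣ℤ (↥ (x ℚ.- y)))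

-- The two sums are tied by the exact identity
--   Σ_{k≤N} C(2k,k+1)/mᵏ = (m-2)/2 · Σ_{k≤N} C(2k,k)/mᵏ - m/2 + C(2N+1,N)/mᴺ,
-- proved by induction on N from C(2N+2,N+1) = 2·C(2N+1,N) and
-- C(2N+3,N+1) = C(2N+2,N+2) + C(2N+2,N+1).  With 2N+1 = pᵃ it remains to show
-- C(2N+1,N) ≡ 2p·δ(a,1)·(-m/p)·mᴺ (mod p²).  Since N·C(2N+1,N) = (2N+1)·C(2N,N-1) and N is
-- prime to 2N+1, pᵃ divides C(pᵃ,N), which settles a ≥ 2.  For a = 1 write C(p,N) = p·t:
-- then N·t = C(p-1,N-1) ≡ (-1)ᴺ⁻¹ and 2N ≡ -1, so t ≡ 2·(-1)ᴺ ≡ 2·(-m/p)·mᴺ (mod p) by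
-- Euler's criterion.  Euler's criterion comes from Wilson's pairing argument: pairing each
-- unit x with c/x shows that the product of all units is -cᴺ or cᴺ according as c is a
-- square or not, and c = 1 gives Wilson's theorem.

module Submission where

module Arithmetic where

  open import Data.Nat as ℕ using (ℕ; zero; suc; _∸_; _^_; _%_; s≤s)
  import Data.Nat.Properties as ℕ
  open import Data.Nat.DivMod using (m≡m%n+[m/n]*n; m%n<n; %-distribˡ-*; m*n/n≡m)
  open import Data.Nat.Divisibility as ℕ using (_∣_; divides)
  open import Data.Nat.Coprimality using (Coprime; coprime-divisor)
  open import Data.Nat.Primality using (Prime; prime⇒irreducible)
  import Data.Integer as ℤ
  import Data.Integer.Properties as ℤ
  open import Data.Sum using (inj₁; inj₂; [_,_]′)
  open import Data.Product using (_,_)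
  open import Relation.Binary.PropositionalEquality
  open import Relation.Nullary using (¬_; contradiction)

  prime≢2⇒%2≡1 : ∀ {p} → Prime p → p ≢ 2 → p % 2 ≡ 1
  prime≢2⇒%2≡1 {p} p-prime p≢2 with p % 2 | m%n<n p 2 | m≡m%n+[m/n]*n p 2
  ... | suc zero    | _            | _         = refl
  ... | suc (suc _) | s≤s (s≤s ()) | _
  ... | zero        | _            | p≡[p/2]*2 =
    [ (λ ()) , (λ 2≡p → contradiction (sym 2≡p) p≢2) ]′
      (prime⇒irreducible p-prime (divides (p ℕ./ 2) p≡[p/2]*2))

  ^-%2≡1 : ∀ {p} → p % 2 ≡ 1 → ∀ a → p ^ a % 2 ≡ 1
  ^-%2≡1 p%2≡1 zero        = refl
  ^-%2≡1 {p} p%2≡1 (suc a) =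
    trans (%-distribˡ-* p (p ^ a) 2) (cong₂ (λ x y → x ℕ.* y % 2) p%2≡1 (^-%2≡1 p%2≡1 a))

  %2≡1⇒≡1+2*[[n∸1]/2] : ∀ {n} → n % 2 ≡ 1 → n ≡ suc (2 ℕ.* ((n ∸ 1) ℕ./ 2))
  %2≡1⇒≡1+2*[[n∸1]/2] {n} n%2≡1 = begin
    n                             ≡⟨ n≡1+h*2 ⟩
    suc (h ℕ.* 2)                 ≡⟨ cong suc (ℕ.*-comm h 2) ⟩
    suc (2 ℕ.* h)                 ≡⟨ cong (λ t → suc (2 ℕ.* t)) (m*n/n≡m h 2) ⟨
    suc (2 ℕ.* (h ℕ.* 2 ℕ./ 2))   ≡⟨ cong (λ t → suc (2 ℕ.* ((t ∸ 1) ℕ./ 2))) n≡1+h*2 ⟨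
    suc (2 ℕ.* ((n ∸ 1) ℕ./ 2))   ∎
    where
    open ≡-Reasoning
    h = n ℕ./ 2
    n≡1+h*2 : n ≡ suc (h ℕ.* 2)
    n≡1+h*2 = trans (m≡m%n+[m/n]*n n 2) (cong (ℕ._+ h ℕ.* 2) n%2≡1)

  coprime-*ˡ : ∀ {a b c} → Coprime a c → Coprime b c → Coprime (a ℕ.* b) c
  coprime-*ˡ {a} a⊥c b⊥c (d∣ab , d∣c) = b⊥c (coprime-divisor d⊥a d∣ab , d∣c)
    where
    d⊥a : Coprime _ a
    d⊥a (e∣d , e∣a) = a⊥c (e∣a , ℕ.∣-trans e∣d d∣c)

  coprime-^ˡ : ∀ {a c} k → Coprime a c → Coprime (a ^ k) c
  coprime-^ˡ zero    _   (d∣1 , _) = ℕ.∣1⇒≡1 d∣1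
  coprime-^ˡ (suc k) a⊥c = coprime-*ˡ a⊥c (coprime-^ˡ k a⊥c)

  prime∤⇒coprime : ∀ {p n} → Prime p → ¬ p ∣ n → Coprime p n
  prime∤⇒coprime p-prime p∤n {d} (d∣p , d∣n) with prime⇒irreducible p-prime d∣p
  ... | inj₁ d≡1  = d≡1
  ... | inj₂ refl = contradiction d∣n p∤n

  coprime-[2n+1]-n : ∀ n → Coprime (suc (2 ℕ.* n)) n
  coprime-[2n+1]-n n {d} (d∣2n+1 , d∣n) =
    ℕ.∣1⇒≡1 (ℕ.∣m+n∣m⇒∣n (subst (d ∣_) (ℕ.+-comm 1 (2 ℕ.* n)) d∣2n+1)
                         (ℕ.∣-trans d∣n (ℕ.n∣m*n 2)))

  ∣i^n∣≡∣i∣^n : ∀ i n → ℤ.∣ i ℤ.^ n ∣ ≡ ℤ.∣ i ∣ ^ n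
  ∣i^n∣≡∣i∣^n i zero    = refl
  ∣i^n∣≡∣i∣^n i (suc n) = trans (ℤ.abs-* i (i ℤ.^ n)) (cong (ℤ.∣ i ∣ ℕ.*_) (∣i^n∣≡∣i∣^n i n))

module Binomial where

  open import Data.Nat
  open import Data.Nat.Properties
  open import Data.Nat.Combinatorics
  open import Data.Nat.Divisibility using (_∣_; divides)
  open import Data.Nat.Coprimality using (Coprime; coprime-divisor)
  open import Relation.Binary.PropositionalEquality
  open import Data.Nat.Solver using (module +-*-Solver)
  open +-*-Solver

  nCk≡nCl : ∀ {n k l} → k + l ≡ n → n C k ≡ n C l
  nCk≡nCl {k = k} {l} refl = trans (nCk≡nC[n∸k] (m≤m+n k l)) (cong ((k + l) C_) (m+n∸m≡n k l))

  [k+1]*[n+1]C[k+1]≡[n+1]*nCk : ∀ n k → suc k * (suc n C suc k) ≡ suc n * (n C k)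
  [k+1]*[n+1]C[k+1]≡[n+1]*nCk zero    zero    = refl
  [k+1]*[n+1]C[k+1]≡[n+1]*nCk zero    (suc k) = *-zeroʳ (suc (suc k))
  [k+1]*[n+1]C[k+1]≡[n+1]*nCk (suc n) zero    =
    trans (*-identityˡ _) (trans (nC1≡n (suc (suc n))) (sym (*-identityʳ (suc (suc n)))))
  [k+1]*[n+1]C[k+1]≡[n+1]*nCk (suc n) (suc k) = begin
    suc (suc k) * (suc (suc n) C suc (suc k))    ≡⟨ cong (suc (suc k) *_) (Pascal (suc n) (suc k)) ⟨
    suc (suc k) * (X + Y)                        ≡⟨ *-distribˡ-+ (suc (suc k)) X Y ⟩
    (X + suc k * X) + suc (suc k) * Y            ≡⟨ cong₂ (λ a b → (X + a) + b)
                                                      ([k+1]*[n+1]C[k+1]≡[n+1]*nCk n k)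
                                                      ([k+1]*[n+1]C[k+1]≡[n+1]*nCk n (suc k)) ⟩
    (X + suc n * (n C k)) + suc n * (n C suc k)  ≡⟨ +-assoc X _ _ ⟩
    X + (suc n * (n C k) + suc n * (n C suc k))  ≡⟨ cong (X +_) (*-distribˡ-+ (suc n) (n C k) (n C suc k)) ⟨
    X + suc n * (n C k + n C suc k)              ≡⟨ cong (λ t → X + suc n * t) (Pascal n k) ⟩
    suc (suc n) * X                              ∎
    where
    open ≡-Reasoning
    Pascal = nCk+nC[k+1]≡[n+1]C[k+1]
    X = suc n C suc k
    Y = suc n C suc (suc k)

  coprime⇒[n+1]∣[n+1]C[k+1] : ∀ {n k} → Coprime (suc n) (suc k) → suc n ∣ suc n C suc k
  coprime⇒[n+1]∣[n+1]C[k+1] {n} {k} cop = coprime-divisor cop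
    (divides (n C k) (trans ([k+1]*[n+1]C[k+1]≡[n+1]*nCk n k) (*-comm (suc n) (n C k))))

  [2n+2]C[n+1]≡2*[2n+1]Cn : ∀ n → 2 * suc n C suc n ≡ 2 * (suc (2 * n) C n)
  [2n+2]C[n+1]≡2*[2n+1]Cn n = begin
    2 * suc n C suc n                ≡⟨ cong (_C suc n) (*-suc 2 n) ⟩
    suc (suc (2 * n)) C suc n        ≡⟨ nCk+nC[k+1]≡[n+1]C[k+1] (suc (2 * n)) n ⟨
    X + suc (2 * n) C suc n          ≡⟨ cong (X +_) (nCk≡nCl {k = suc n} {n} (cong suc n+n≡2n)) ⟩
    X + X                            ≡⟨ cong (X +_) (+-identityʳ X) ⟨
    2 * X                            ∎
    where
    open ≡-Reasoning
    X = suc (2 * n) C n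
    n+n≡2n : n + n ≡ 2 * n
    n+n≡2n = solve 1 (λ n → n :+ n := con 2 :* n) refl n

  [2n+3]C[n+1]≡[2n+2]C[n+2]+[2n+2]C[n+1] : ∀ n →
    suc (2 * suc n) C suc n ≡ 2 * suc n C suc (suc n) + 2 * suc n C suc n
  [2n+3]C[n+1]≡[2n+2]C[n+2]+[2n+2]C[n+1] n = begin
    suc M C suc n                ≡⟨ nCk+nC[k+1]≡[n+1]C[k+1] M n ⟨
    M C n + M C suc n            ≡⟨ cong (_+ M C suc n) (nCk≡nCl {k = n} {suc (suc n)} n+[n+2]≡M) ⟩
    M C suc (suc n) + M C suc n  ∎
    where
    open ≡-Reasoning
    M = 2 * suc n
    n+[n+2]≡M : n + suc (suc n) ≡ M
    n+[n+2]≡M = solve 1 (λ n → n :+ (con 2 :+ n) := con 2 :* (con 1 :+ n)) refl n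

module Congruence where

  open import Data.Nat as ℕ using (ℕ; zero; suc)
  import Data.Nat.Properties as ℕ
  import Data.Nat.Divisibility as ℕ
  open import Data.Nat.Primality using (Prime; euclidsLemma)
  open import Data.Integer as ℤ using (ℤ; +_; 0ℤ; 1ℤ; _+_; _*_; _-_; -_; ∣_∣)
  import Data.Integer.Properties as ℤ
  open import Data.Integer.Divisibility.Signed
  open import Data.Integer.DivMod using (_%ℕ_; _/ℕ_; a≡a%ℕn+[a/ℕn]*n)
  open import Data.Sum using (_⊎_; inj₁; inj₂; [_,_])
  open import Relation.Binary.Bundles using (Setoid)
  open import Relation.Binary.PropositionalEquality
    using (_≡_; refl; sym; subst; subst₂; cong; module ≡-Reasoning)
  open import Relation.Nullary using (¬_; contradiction; yes; no)
  open import Data.Integer.Solver using (module +-*-Solver)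
  open +-*-Solver

  infix 4 _≡_[modℤ_]

  -- A record rather than a definition, so that a, b and n can be inferred from the type.
  record _≡_[modℤ_] (a b : ℤ) (n : ℕ) : Set where
    constructor modℤ
    field n∣a-b : + n ∣ a - b

  module _ {n : ℕ} where

    ≡-refl : ∀ {a} → a ≡ a [modℤ n ]
    ≡-refl {a} = modℤ (subst (+ n ∣_) (sym (ℤ.+-inverseʳ a)) (divides 0ℤ refl))

    ≡-reflexive : ∀ {a b} → a ≡ b → a ≡ b [modℤ n ]
    ≡-reflexive refl = ≡-refl

    ≡-sym : ∀ {a b} → a ≡ b [modℤ n ] → b ≡ a [modℤ n ]
    ≡-sym {a} {b} (modℤ h) =
      modℤ (subst (+ n ∣_) (solve 2 (λ a b → :- (a :- b) := b :- a) refl a b) (∣m⇒∣-m h))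

    ≡-trans : ∀ {a b c} → a ≡ b [modℤ n ] → b ≡ c [modℤ n ] → a ≡ c [modℤ n ]
    ≡-trans {a} {b} {c} (modℤ h) (modℤ k) =
      modℤ (subst (+ n ∣_) (solve 3 (λ a b c → (a :- b) :+ (b :- c) := a :- c) refl a b c) (∣m∣n⇒∣m+n h k))

    +-cong : ∀ {a b c d} → a ≡ b [modℤ n ] → c ≡ d [modℤ n ] → a + c ≡ b + d [modℤ n ]
    +-cong {a} {b} {c} {d} (modℤ h) (modℤ k) = modℤ (subst (+ n ∣_)
      (solve 4 (λ a b c d → (a :- b) :+ (c :- d) := (a :+ c) :- (b :+ d)) refl a b c d) (∣m∣n⇒∣m+n h k))

    -‿cong : ∀ {a b} → a ≡ b [modℤ n ] → - a ≡ - b [modℤ n ]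
    -‿cong {a} {b} (modℤ h) =
      modℤ (subst (+ n ∣_) (solve 2 (λ a b → :- (a :- b) := :- a :- :- b) refl a b) (∣m⇒∣-m h))

    *-cong : ∀ {a b c d} → a ≡ b [modℤ n ] → c ≡ d [modℤ n ] → a * c ≡ b * d [modℤ n ]
    *-cong {a} {b} {c} {d} (modℤ h) (modℤ k) = modℤ (subst (+ n ∣_)
      (solve 4 (λ a b c d → (a :- b) :* c :+ b :* (c :- d) := a :* c :- b :* d) refl a b c d)
      (∣m∣n⇒∣m+n (∣m⇒∣m*n c h) (∣n⇒∣m*n b k)))

    *-congˡ : ∀ c {a b} → a ≡ b [modℤ n ] → c * a ≡ c * b [modℤ n ]
    *-congˡ c = *-cong (≡-refl {c})

    *-congʳ : ∀ c {a b} → a ≡ b [modℤ n ] → a * c ≡ b * c [modℤ n ]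
    *-congʳ c h = *-cong h (≡-refl {c})

    multiple≡0 : ∀ k → k * + n ≡ 0ℤ [modℤ n ]
    multiple≡0 k = modℤ (divides k (ℤ.+-identityʳ (k * + n)))

    n≡0 : + n ≡ 0ℤ [modℤ n ]
    n≡0 = subst (_≡ 0ℤ [modℤ n ]) (ℤ.*-identityˡ (+ n)) (multiple≡0 1ℤ)

    ≡0⇒∣ : ∀ {a} → a ≡ 0ℤ [modℤ n ] → n ℕ.∣ ∣ a ∣
    ≡0⇒∣ {a} (modℤ h) = subst (λ z → n ℕ.∣ ∣ z ∣) (ℤ.+-identityʳ a) (∣⇒∣ᵤ h)

    ∣⇒≡0 : ∀ {a} → n ℕ.∣ ∣ a ∣ → a ≡ 0ℤ [modℤ n ]
    ∣⇒≡0 {a} h = modℤ (∣ᵤ⇒∣ (subst (λ z → n ℕ.∣ ∣ z ∣) (sym (ℤ.+-identityʳ a)) h))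

    ≡⇒-≡0 : ∀ {a b} → a ≡ b [modℤ n ] → a - b ≡ 0ℤ [modℤ n ]
    ≡⇒-≡0 {a} {b} (modℤ h) = modℤ (subst (+ n ∣_) (sym (ℤ.+-identityʳ (a - b))) h)

    -≡0⇒≡ : ∀ {a b} → a - b ≡ 0ℤ [modℤ n ] → a ≡ b [modℤ n ]
    -≡0⇒≡ {a} {b} (modℤ h) = modℤ (subst (+ n ∣_) (ℤ.+-identityʳ (a - b)) h)

  modℤ-setoid : ℕ → Setoid _ _
  modℤ-setoid n = record
    { Carrier       = ℤ
    ; _≈_           = _≡_[modℤ n ]
    ; isEquivalence = record { refl = ≡-refl ; sym = ≡-sym ; trans = ≡-trans }
    }

  module ≡-mod-Reasoning (n : ℕ) where
    open import Relation.Binary.Reasoning.Setoid (modℤ-setoid n) public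

  ≡-%ℕ : ∀ z n .{{_ : ℕ.NonZero n}} → z ≡ + (z %ℕ n) [modℤ n ]
  ≡-%ℕ z n = modℤ (divides (z /ℕ n) (begin
    z - + r                  ≡⟨ cong (_- + r) (a≡a%ℕn+[a/ℕn]*n z n) ⟩
    + r + q * + n - + r      ≡⟨ solve 2 (λ r q → r :+ q :- r := q) refl (+ r) (q * + n) ⟩
    q * + n                  ∎))
    where
    open ≡-Reasoning
    r = z %ℕ n
    q = z /ℕ n

  ≡-mod-injective : ∀ {n a b} → a ℕ.< n → b ℕ.< n → + a ≡ + b [modℤ n ] → a ≡ b
  ≡-mod-injective {n} {a} {b} a<n b<n a≡b with ∣ + a - + b ∣ ℕ.≟ 0
  ... | yes ∣a-b∣≡0 = ℤ.+-injective (ℤ.i-j≡0⇒i≡j (+ a) (+ b) (ℤ.∣i∣≡0⇒i≡0 ∣a-b∣≡0))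
  ... | no ∣a-b∣≢0  =
    contradiction (ℕ.∣⇒≤ ⦃ ℕ.≢-nonZero ∣a-b∣≢0 ⦄ (≡0⇒∣ (≡⇒-≡0 a≡b))) (ℕ.<⇒≱ ∣a-b∣<n)
    where
    ∣a-b∣<n : ∣ + a - + b ∣ ℕ.< n
    ∣a-b∣<n = ℕ.≤-<-trans (subst (λ z → ∣ z ∣ ℕ.≤ a ℕ.⊔ b) (sym (ℤ.m-n≡m⊖n a b))
                                 (ℤ.∣m⊝n∣≤m⊔n a b))
                          (ℕ.⊔-lub a<n b<n)

  0<a<n⇒≢0 : ∀ {n a} → 0 ℕ.< a → a ℕ.< n → ¬ + a ≡ 0ℤ [modℤ n ]
  0<a<n⇒≢0 0<a a<n a≡0 = ℕ.<⇒≢ 0<a (sym (≡-mod-injective a<n (ℕ.≤-trans 0<a (ℕ.<⇒≤ a<n)) a≡0))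

  *-scale : ∀ k {n a b} → a ≡ b [modℤ n ] → + k * a ≡ + k * b [modℤ k ℕ.* n ]
  *-scale k {n} {a} {b} (modℤ n∣a-b) = modℤ (subst₂ _∣_ (sym (ℤ.pos-* k n))
    (solve 3 (λ k a b → k :* (a :- b) := k :* a :- k :* b) refl (+ k) a b) (*-monoʳ-∣ (+ k) n∣a-b))

  module _ {p : ℕ} (p-prime : Prime p) where

    ≡0-euclid : ∀ {a b} → a * b ≡ 0ℤ [modℤ p ] → a ≡ 0ℤ [modℤ p ] ⊎ b ≡ 0ℤ [modℤ p ]
    ≡0-euclid {a} {b} h with euclidsLemma ∣ a ∣ ∣ b ∣ p-prime (subst (p ℕ.∣_) (ℤ.abs-* a b) (≡0⇒∣ h))
    ... | inj₁ p∣a = inj₁ (∣⇒≡0 p∣a)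
    ... | inj₂ p∣b = inj₂ (∣⇒≡0 p∣b)

    *-cancelˡ-≡ : ∀ c {a b} → ¬ c ≡ 0ℤ [modℤ p ] → c * a ≡ c * b [modℤ p ] → a ≡ b [modℤ p ]
    *-cancelˡ-≡ c {a} {b} c≢0 ca≡cb = [ (λ c≡0 → contradiction c≡0 c≢0) , -≡0⇒≡ ] (≡0-euclid c[a-b]≡0)
      where
      c[a-b]≡0 : c * (a - b) ≡ 0ℤ [modℤ p ]
      c[a-b]≡0 = subst (_≡ 0ℤ [modℤ p ])
        (solve 3 (λ a b c → c :* a :- c :* b := c :* (a :- b)) refl a b c) (≡⇒-≡0 ca≡cb)

    square-roots : ∀ {y z} → z * z ≡ y * y [modℤ p ] → z ≡ y [modℤ p ] ⊎ z ≡ - y [modℤ p ]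
    square-roots {y} {z} z²≡y² with ≡0-euclid [z-y][z+y]≡0
      where
      [z-y][z+y]≡0 : (z - y) * (z + y) ≡ 0ℤ [modℤ p ]
      [z-y][z+y]≡0 = subst (_≡ 0ℤ [modℤ p ])
        (solve 2 (λ z y → z :* z :- y :* y := (z :- y) :* (z :+ y)) refl z y) (≡⇒-≡0 z²≡y²)
    ... | inj₁ z-y≡0 = inj₁ (-≡0⇒≡ z-y≡0)
    ... | inj₂ z+y≡0 =
      inj₂ (-≡0⇒≡ (subst (_≡ 0ℤ [modℤ p ]) (solve 2 (λ z y → z :+ y := z :- :- y) refl z y) z+y≡0))


module QuadraticResidues where

  open import Defs using (legendre)
  open Congruence
  open import Data.Nat as ℕ using (ℕ; zero; suc; z≤n; s≤s; _<_)
  import Data.Nat.Properties as ℕ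
  open import Data.Nat.Primality using (Prime; prime⇒nonTrivial)
  open import Data.Nat.Coprimality using (coprime-Bézout; prime⇒coprime)
  open import Data.Nat.GCD using (module Bézout)
  open import Data.Integer as ℤ using (ℤ; +_; 0ℤ; 1ℤ; -1ℤ; _+_; _*_; _-_; -_; _^_)
  import Data.Integer.Properties as ℤ
  open import Data.Integer.DivMod using (_%ℕ_; n%ℕd<d)
  open import Data.Nat.DivMod using (m%n<n)
  open import Data.Fin using (Fin; toℕ; fromℕ<)
  open import Data.Fin.Properties using (any?; toℕ<n; toℕ-fromℕ<)
  open import Data.List using (List; []; _∷_; length; foldr; filter; applyUpTo)
  open import Data.List.Properties using (filter-all; length-applyUpTo)
  open import Data.List.Membership.Propositional using (_∈_; _∉_)
  open import Data.List.Membership.Propositional.Properties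
    using (∈-filter⁺; ∈-filter⁻; ∈-applyUpTo⁺; ∈-applyUpTo⁻)
  open import Data.List.Relation.Unary.Any using (here; there)
  open import Data.List.Relation.Unary.All as All using (All)
  open import Data.List.Relation.Unary.AllPairs using (_∷_)
  open import Data.List.Relation.Unary.Unique.Propositional using (Unique)
  import Data.List.Relation.Unary.Unique.Propositional.Properties as Unique
  open import Data.Product using (∃-syntax; _×_; _,_; proj₁; proj₂)
  open import Data.Sum using ([_,_]′)
  open import Data.Bool using (if_then_else_)
  open import Relation.Binary.PropositionalEquality
  open import Function using (_∘_)
  open import Relation.Nullary using (¬_; ¬?; yes; no; does; Dec; contradiction)
  open import Data.Integer.Solver using (module +-*-Solver)
  open +-*-Solver

  ∏ : List ℤ → ℤ
  ∏ = foldr _*_ 1ℤ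

  remove : ℤ → List ℤ → List ℤ
  remove w = filter (λ z → ¬? (z ℤ.≟ w))

  ∈-tail : ∀ {v x : ℤ} {L} → v ∈ x ∷ L → v ≢ x → v ∈ L
  ∈-tail (here v≡x)  v≢x = contradiction v≡x v≢x
  ∈-tail (there v∈L) _   = v∈L

  module _ {w : ℤ} where

    ∈-remove⁺ : ∀ {z xs} → z ∈ xs → z ≢ w → z ∈ remove w xs
    ∈-remove⁺ = ∈-filter⁺ (λ z → ¬? (z ℤ.≟ w))

    ∈-remove⁻ : ∀ {z xs} → z ∈ remove w xs → z ∈ xs × z ≢ w
    ∈-remove⁻ = ∈-filter⁻ (λ z → ¬? (z ℤ.≟ w))

    remove-unique : ∀ {xs} → Unique xs → Unique (remove w xs)
    remove-unique = Unique.filter⁺ (λ z → ¬? (z ℤ.≟ w))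

    remove-∉ : ∀ {xs} → w ∉ xs → remove w xs ≡ xs
    remove-∉ w∉xs =
      filter-all (λ z → ¬? (z ℤ.≟ w)) (All.tabulate (λ z∈xs z≡w → w∉xs (subst (_∈ _) z≡w z∈xs)))

    ∏-remove : ∀ {xs} → Unique xs → w ∈ xs → ∏ xs ≡ w * ∏ (remove w xs)
    ∏-remove {x ∷ xs} (x∉xs ∷ _) (here refl) with x ℤ.≟ x
    ... | yes _   = cong (λ l → x * ∏ l) (sym (remove-∉ (λ x∈xs → All.lookup x∉xs x∈xs refl)))
    ... | no x≢x  = contradiction refl x≢x
    ∏-remove {x ∷ xs} (x∉xs ∷ u) (there w∈xs) with x ℤ.≟ w
    ... | yes refl = contradiction refl (All.lookup x∉xs w∈xs)
    ... | no _     = trans (cong (x *_) (∏-remove u w∈xs))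
                           (solve 3 (λ x w r → x :* (w :* r) := w :* (x :* r)) refl x w (∏ (remove w xs)))

    length-remove : ∀ {xs} → Unique xs → w ∈ xs → length xs ≡ suc (length (remove w xs))
    length-remove {x ∷ xs} (x∉xs ∷ _) (here refl) with x ℤ.≟ x
    ... | yes _   = cong (λ l → suc (length l)) (sym (remove-∉ (λ x∈xs → All.lookup x∉xs x∈xs refl)))
    ... | no x≢x  = contradiction refl x≢x
    length-remove {x ∷ xs} (x∉xs ∷ u) (there w∈xs) with x ℤ.≟ w
    ... | yes refl = contradiction refl (All.lookup x∉xs w∈xs)
    ... | no _     = cong suc (length-remove u w∈xs)

  record Reduced (p : ℕ) (L : List ℤ) : Set where
    field
      unique    : Unique L
      canonical : ∀ {x y} → x ∈ L → y ∈ L → x ≡ y [modℤ p ] → x ≡ y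
      nonzero   : ∀ {x} → x ∈ L → ¬ x ≡ 0ℤ [modℤ p ]
  open Reduced

  reduced-tail : ∀ {p x L} → Reduced p (x ∷ L) → Reduced p L
  reduced-tail R = record
    { unique    = tail (unique R)
    ; canonical = λ x∈ y∈ → canonical R (there x∈) (there y∈)
    ; nonzero   = nonzero R ∘ there
    }
    where
    tail : ∀ {x L} → Unique (x ∷ L) → Unique L
    tail (_ ∷ u) = u

  reduced-remove : ∀ {p w L} → Reduced p L → Reduced p (remove w L)
  reduced-remove R = record
    { unique    = remove-unique (unique R)
    ; canonical = λ x∈ y∈ → canonical R (proj₁ (∈-remove⁻ x∈)) (proj₁ (∈-remove⁻ y∈))
    ; nonzero   = λ x∈ → nonzero R (proj₁ (∈-remove⁻ x∈))
    }

  module _ {p : ℕ} (p-prime : Prime p) where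

    PairedBy : ℤ → List ℤ → Set
    PairedBy c L = ∀ {x} → x ∈ L → ∃[ w ] w ∈ L × w ≢ x × x * w ≡ c [modℤ p ]

    same-partner⇒≡ : ∀ {c L x y z} → Reduced p L → x ∈ L → y ∈ L → z ∈ L →
                     x * z ≡ c [modℤ p ] → y * z ≡ c [modℤ p ] → x ≡ y
    same-partner⇒≡ {c} {x = x} {y} {z} R x∈ y∈ z∈ xz≡c yz≡c =
      canonical R x∈ y∈ (*-cancelˡ-≡ p-prime z (nonzero R z∈) (begin
        z * x ≡⟨ ℤ.*-comm z x ⟩
        x * z ≈⟨ xz≡c ⟩
        c     ≈⟨ yz≡c ⟨
        y * z ≡⟨ ℤ.*-comm y z ⟩
        z * y ∎))
      where open ≡-mod-Reasoning p

    paired-remove : ∀ {c x w L} → Reduced p (x ∷ L) → PairedBy c (x ∷ L) →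
                    w ∈ L → x * w ≡ c [modℤ p ] → PairedBy c (remove w L)
    paired-remove {c} {x} {w} {L} R P w∈L xw≡c {z} z∈L′ = avoid-x-and-w (P (there z∈L))
      where
      z∈L = proj₁ (∈-remove⁻ {xs = L} z∈L′)
      z≢w = proj₂ (∈-remove⁻ {xs = L} z∈L′)
      x∉L : Unique (x ∷ L) → x ∉ L
      x∉L (x∉ ∷ _) x∈L = All.lookup x∉ x∈L refl
      avoid-x-and-w : ∃[ v ] v ∈ x ∷ L × v ≢ z × z * v ≡ c [modℤ p ] →
                      ∃[ v ] v ∈ remove w L × v ≢ z × z * v ≡ c [modℤ p ]
      avoid-x-and-w (v , v∈ , v≢z , zv≡c) = v , ∈-remove⁺ (∈-tail v∈ v≢x) v≢w , v≢z , zv≡c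
        where
        v≢x : v ≢ x
        v≢x refl = z≢w (same-partner⇒≡ R (there z∈L) (there w∈L) (here refl) zv≡c
                          (≡-trans (≡-reflexive (ℤ.*-comm w x)) xw≡c))
        v≢w : v ≢ w
        v≢w refl = x∉L (unique R)
                     (subst (_∈ L) (same-partner⇒≡ R (there z∈L) (here refl) (there w∈L) zv≡c xw≡c) z∈L)

    ∏-paired : ∀ {c L} → Reduced p L → PairedBy c L →
               ∃[ k ] length L ≡ 2 ℕ.* k × (∏ L ≡ c ^ k [modℤ p ])
    ∏-paired {c} {L} = go (length L) L ℕ.≤-refl
      where
      go : ∀ n L → length L ℕ.≤ n → Reduced p L → PairedBy c L →
           ∃[ k ] length L ≡ 2 ℕ.* k × (∏ L ≡ c ^ k [modℤ p ])
      go _       []      _            _ _ = 0 , refl , ≡-refl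
      go (suc n) (x ∷ L) (s≤s |L|≤n) R P = pair-off (P (here refl))
        where
        pair-off : ∃[ w ] w ∈ x ∷ L × w ≢ x × x * w ≡ c [modℤ p ] →
                   ∃[ k ] suc (length L) ≡ 2 ℕ.* k × (x * ∏ L ≡ c ^ k [modℤ p ])
        pair-off (w , here w≡x  , w≢x , _)    = contradiction w≡x w≢x
        pair-off (w , there w∈L , _   , xw≡c) = suc k , length-step , ∏-step
          where
          L′ = remove w L
          |L|≡1+|L′| = length-remove (unique (reduced-tail R)) w∈L
          |L′|≤n = ℕ.≤-trans (ℕ.n≤1+n _) (subst (ℕ._≤ n) |L|≡1+|L′| |L|≤n)
          rest = go n L′ |L′|≤n (reduced-remove (reduced-tail R)) (paired-remove R P w∈L xw≡c)
          k = proj₁ rest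
          length-step : suc (length L) ≡ 2 ℕ.* suc k
          length-step = begin
            suc (length L)          ≡⟨ cong suc |L|≡1+|L′| ⟩
            suc (suc (length L′))   ≡⟨ cong (suc ∘ suc) (proj₁ (proj₂ rest)) ⟩
            suc (suc (2 ℕ.* k))     ≡⟨ ℕ.*-suc 2 k ⟨
            2 ℕ.* suc k             ∎
            where open ≡-Reasoning
          ∏-step : x * ∏ L ≡ c * c ^ k [modℤ p ]
          ∏-step = begin
            x * ∏ L                 ≡⟨ cong (x *_) (∏-remove (unique (reduced-tail R)) w∈L) ⟩
            x * (w * ∏ L′)          ≡⟨ ℤ.*-assoc x w (∏ L′) ⟨
            x * w * ∏ L′            ≈⟨ *-cong xw≡c (proj₂ (proj₂ rest)) ⟩
            c * c ^ k               ∎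
            where open ≡-mod-Reasoning p

  ℕ-eq⇒ℤ-eq : ∀ a b c d e → a ℕ.+ b ℕ.* c ≡ d ℕ.* e → + a + + b * + c ≡ + d * + e
  ℕ-eq⇒ℤ-eq a b c d e eq = begin
    + a + + b * + c     ≡⟨ cong (λ t → + a + t) (ℤ.pos-* b c) ⟨
    + a + + (b ℕ.* c)   ≡⟨ ℤ.pos-+ a (b ℕ.* c) ⟨
    + (a ℕ.+ b ℕ.* c)   ≡⟨ cong +_ eq ⟩
    + (d ℕ.* e)         ≡⟨ ℤ.pos-* d e ⟩
    + d * + e           ∎
    where open ≡-Reasoning

  module Units {n : ℕ} (p-prime : Prime (suc n)) where

    private
      p = suc n

    units : List ℤ
    units = applyUpTo (λ i → + suc i) n

    ∈-units⁺ : ∀ {i} → i < n → + suc i ∈ units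
    ∈-units⁺ = ∈-applyUpTo⁺ (λ i → + suc i)

    ∈-units⁻ : ∀ {x} → x ∈ units → ∃[ i ] i < n × x ≡ + suc i
    ∈-units⁻ = ∈-applyUpTo⁻ (λ i → + suc i)

    length-units : length units ≡ n
    length-units = length-applyUpTo (λ i → + suc i) n

    units-reduced : Reduced p units
    units-reduced = record
      { unique    = Unique.applyUpTo⁺₁ (λ i → + suc i) n
                      (λ i<j _ e → ℕ.<⇒≢ i<j (ℕ.suc-injective (ℤ.+-injective e)))
      ; canonical = λ x∈ y∈ → residues-canonical (∈-units⁻ x∈) (∈-units⁻ y∈)
      ; nonzero   = λ x∈ → residue-nonzero (∈-units⁻ x∈)
      }
      where
      residues-canonical : ∀ {x y} → ∃[ i ] i < n × x ≡ + suc i → ∃[ j ] j < n × y ≡ + suc j →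
                           x ≡ y [modℤ p ] → x ≡ y
      residues-canonical (i , i<n , refl) (j , j<n , refl) x≡y =
        cong +_ (≡-mod-injective (s≤s i<n) (s≤s j<n) x≡y)
      residue-nonzero : ∀ {x} → ∃[ i ] i < n × x ≡ + suc i → ¬ x ≡ 0ℤ [modℤ p ]
      residue-nonzero (i , i<n , refl) = 0<a<n⇒≢0 (s≤s z≤n) (s≤s i<n)

    ≢0⇒≡unit : ∀ {z} → ¬ z ≡ 0ℤ [modℤ p ] → ∃[ x ] x ∈ units × z ≡ x [modℤ p ]
    ≢0⇒≡unit {z} z≢0 with z %ℕ p | n%ℕd<d z p | ≡-%ℕ z p
    ... | zero  | _           | z≡0 = contradiction z≡0 z≢0
    ... | suc i | s≤s i<n     | z≡x = + suc i , ∈-units⁺ i<n , z≡x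

    unit-invertible : ∀ {x} → x ∈ units → ∃[ u ] x * u ≡ 1ℤ [modℤ p ]
    unit-invertible x∈ with ∈-units⁻ x∈
    ... | i , i<n , refl with coprime-Bézout (prime⇒coprime p-prime (s≤s i<n))
    ... | Bézout.+- k l 1+la≡kp = - + l , (begin
      a * - + l             ≡⟨ solve 2 (λ a l → a :* :- l := con 1ℤ :- (con 1ℤ :+ l :* a))
                                      refl a (+ l) ⟩
      1ℤ - (1ℤ + + l * a)   ≡⟨ cong (λ t → 1ℤ - t) (ℕ-eq⇒ℤ-eq 1 l (suc i) k p 1+la≡kp) ⟩
      1ℤ - + k * + p        ≈⟨ +-cong (≡-refl {a = 1ℤ}) (-‿cong (multiple≡0 (+ k))) ⟩
      1ℤ - 0ℤ               ≡⟨⟩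
      1ℤ                    ∎)
      where
      open ≡-mod-Reasoning p
      a = + suc i
    ... | Bézout.-+ k l 1+kp≡la = + l , (begin
      a * + l               ≡⟨ ℤ.*-comm a (+ l) ⟩
      + l * a               ≡⟨ ℕ-eq⇒ℤ-eq 1 k p l (suc i) 1+kp≡la ⟨
      1ℤ + + k * + p        ≈⟨ +-cong (≡-refl {a = 1ℤ}) (multiple≡0 (+ k)) ⟩
      1ℤ + 0ℤ               ≡⟨⟩
      1ℤ                    ∎)
      where
      open ≡-mod-Reasoning p
      a = + suc i

    unit-partner : ∀ {c x} → ¬ c ≡ 0ℤ [modℤ p ] → x ∈ units →
                   ∃[ w ] w ∈ units × x * w ≡ c [modℤ p ]
    unit-partner {c} {x} c≢0 x∈ = w , w∈ , (begin
      x * w            ≈⟨ *-congˡ x cu≡w ⟨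
      x * (c * u)      ≡⟨ solve 3 (λ c x u → x :* (c :* u) := c :* (x :* u)) refl c x u ⟩
      c * (x * u)      ≈⟨ *-congˡ c xu≡1 ⟩
      c * 1ℤ           ≡⟨ ℤ.*-identityʳ c ⟩
      c                ∎)
      where
      open ≡-mod-Reasoning p
      u = proj₁ (unit-invertible x∈)
      xu≡1 = proj₂ (unit-invertible x∈)
      cu≢0 : ¬ c * u ≡ 0ℤ [modℤ p ]
      cu≢0 cu≡0 = c≢0 (begin
        c              ≡⟨ ℤ.*-identityʳ c ⟨
        c * 1ℤ         ≈⟨ *-congˡ c xu≡1 ⟨
        c * (x * u)    ≡⟨ solve 3 (λ c x u → c :* (x :* u) := x :* (c :* u)) refl c x u ⟩
        x * (c * u)    ≈⟨ *-congˡ x cu≡0 ⟩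
        x * 0ℤ         ≡⟨ ℤ.*-zeroʳ x ⟩
        0ℤ             ∎)
      w = proj₁ (≢0⇒≡unit cu≢0)
      w∈ = proj₁ (proj₂ (≢0⇒≡unit cu≢0))
      cu≡w = proj₂ (proj₂ (≢0⇒≡unit cu≢0))

  data LegendreView (x : ℤ) (q : ℕ) : ℤ → Set where
    divisible : x %ℕ suc q ≡ 0 → LegendreView x q 0ℤ
    square    : (y : Fin (suc q)) → toℕ y ℕ.* toℕ y ℕ.% suc q ≡ x %ℕ suc q → LegendreView x q 1ℤ
    nonsquare : (∀ (y : Fin (suc q)) → toℕ y ℕ.* toℕ y ℕ.% suc q ≢ x %ℕ suc q) →
                LegendreView x q -1ℤ

  legendre-view : ∀ x q → LegendreView x q (legendre x (suc q))
  legendre-view x q with x %ℕ suc q in x%p≡r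
  ... | zero  = divisible x%p≡r
  ... | suc r = from-search (any? (λ (y : Fin (suc q)) → toℕ y ℕ.* toℕ y ℕ.% suc q ℕ.≟ suc r))
    where
    from-search : (d : Dec (∃[ y ] toℕ y ℕ.* toℕ y ℕ.% suc q ≡ suc r)) →
                  LegendreView x q (if does d then 1ℤ else -1ℤ)
    from-search (yes (y , y²≡r)) = square y (trans y²≡r (sym x%p≡r))
    from-search (no ∄y)          = nonsquare (λ y y²≡x → ∄y (y , trans y²≡x x%p≡r))

  [-1]ⁿ*iⁿ≡[-i]ⁿ : ∀ i n → -1ℤ ^ n * i ^ n ≡ (- i) ^ n
  [-1]ⁿ*iⁿ≡[-i]ⁿ i zero    = refl
  [-1]ⁿ*iⁿ≡[-i]ⁿ i (suc n) = begin
    (-1ℤ * -1ℤ ^ n) * (i * i ^ n)   ≡⟨ solve 4 (λ a s i t → (a :* s) :* (i :* t) := (a :* i) :* (s :* t))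
                                               refl -1ℤ (-1ℤ ^ n) i (i ^ n) ⟩
    (-1ℤ * i) * (-1ℤ ^ n * i ^ n)   ≡⟨ cong₂ _*_ (ℤ.-1*i≡-i i) ([-1]ⁿ*iⁿ≡[-i]ⁿ i n) ⟩
    - i * (- i) ^ n                 ∎
    where open ≡-Reasoning

  module EulerCriterion (N : ℕ) (p-prime : Prime (suc (2 ℕ.* N))) where

    open Units p-prime
    open Reduced units-reduced
      renaming (unique to units-unique; canonical to units-canonical; nonzero to units-nonzero)

    private
      p = suc (2 ℕ.* N)
      1<p : 1 < p
      1<p = ℕ.nonTrivial⇒n>1 p ⦃ prime⇒nonTrivial p-prime ⦄

    opposite-unit : ∀ {y} → y ∈ units → ∃[ y′ ] y′ ∈ units × y′ ≢ y × y′ ≡ - y [modℤ p ]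
    opposite-unit y∈ = opposite (∈-units⁻ y∈)
      where
      opposite : ∀ {y} → ∃[ i ] i < 2 ℕ.* N × y ≡ + suc i →
                 ∃[ y′ ] y′ ∈ units × y′ ≢ y × y′ ≡ - y [modℤ p ]
      opposite (i , i<2N , refl) = y′ , ∈-units⁺ j<2N , y′≢y , y′≡-y
        where
        y = + suc i
        j = 2 ℕ.* N ℕ.∸ suc i
        y′ = + suc j
        j<2N : j < 2 ℕ.* N
        j<2N = subst (j ℕ.<_) (ℕ.m+[n∸m]≡n i<2N) (ℕ.m<n+m j (s≤s z≤n))
        i+j+2≡p : suc i ℕ.+ suc j ≡ p
        i+j+2≡p = trans (ℕ.+-suc (suc i) j) (cong suc (ℕ.m+[n∸m]≡n i<2N))
        y′≢y : y′ ≢ y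
        y′≢y y′≡y = ℕ.even≢odd (suc i) N (begin
          2 ℕ.* suc i           ≡⟨ cong (suc i ℕ.+_) (ℕ.+-identityʳ (suc i)) ⟩
          suc i ℕ.+ suc i       ≡⟨ cong (λ t → suc i ℕ.+ t) (ℤ.+-injective (sym y′≡y)) ⟩
          suc i ℕ.+ suc j       ≡⟨ i+j+2≡p ⟩
          p                     ∎)
          where open ≡-Reasoning
        y′≡-y : y′ ≡ - y [modℤ p ]
        y′≡-y = begin
          y′                     ≡⟨ solve 2 (λ y y′ → y′ := (y :+ y′) :- y) refl y y′ ⟩
          (y + y′) - y           ≡⟨ cong (_- y) (trans (sym (ℤ.pos-+ (suc i) (suc j))) (cong +_ i+j+2≡p)) ⟩
          + p - y                ≈⟨ +-cong n≡0 (≡-refl {a = - y}) ⟩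
          0ℤ - y                 ≡⟨ ℤ.+-identityˡ (- y) ⟩
          - y                    ∎
          where open ≡-mod-Reasoning p

    module _ {c y y′ : ℤ} (y∈ : y ∈ units) (y′∈ : y′ ∈ units) (y′≡-y : y′ ≡ - y [modℤ p ])
             (y²≡c : y * y ≡ c [modℤ p ]) where

      private
        y′²≡c : y′ * y′ ≡ c [modℤ p ]
        y′²≡c = ≡-trans (*-cong y′≡-y y′≡-y)
                  (≡-trans (≡-reflexive (solve 1 (λ y → :- y :* :- y := y :* y) refl y)) y²≡c)

        c≢0 : ¬ c ≡ 0ℤ [modℤ p ]
        c≢0 c≡0 = [ units-nonzero y∈ , units-nonzero y∈ ]′ (≡0-euclid p-prime (≡-trans y²≡c c≡0))

        partner-off-roots : ∀ {z} → z ∈ units → z ≢ y → z ≢ y′ →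
                            ∃[ w ] w ∈ units × z * w ≡ c [modℤ p ] →
                            ∃[ w ] w ∈ remove y′ (remove y units) × w ≢ z × z * w ≡ c [modℤ p ]
        partner-off-roots {z} z∈ z≢y z≢y′ (w , w∈ , zw≡c) =
          w , ∈-remove⁺ (∈-remove⁺ w∈ w≢y) w≢y′ , w≢z , zw≡c
          where
          w≢y : w ≢ y
          w≢y refl = z≢y (same-partner⇒≡ p-prime units-reduced z∈ y∈ y∈ zw≡c y²≡c)
          w≢y′ : w ≢ y′
          w≢y′ refl = z≢y′ (same-partner⇒≡ p-prime units-reduced z∈ y′∈ y′∈ zw≡c y′²≡c)
          w≢z : w ≢ z
          w≢z refl = [ z≢y ∘ units-canonical z∈ y∈
                     , z≢y′ ∘ units-canonical z∈ y′∈ ∘ (λ z≡-y → ≡-trans z≡-y (≡-sym y′≡-y))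
                     ]′ (square-roots p-prime (≡-trans zw≡c (≡-sym y²≡c)))

      paired-off-roots : PairedBy p-prime c (remove y′ (remove y units))
      paired-off-roots {z} z∈L₂ = partner-off-roots z∈ z≢y z≢y′ (unit-partner c≢0 z∈)
        where
        z∈L₁ : z ∈ remove y units
        z∈L₁ = proj₁ (∈-remove⁻ {xs = remove y units} z∈L₂)
        z≢y′ = proj₂ (∈-remove⁻ {xs = remove y units} z∈L₂)
        z∈ = proj₁ (∈-remove⁻ {xs = units} z∈L₁)
        z≢y = proj₂ (∈-remove⁻ {xs = units} z∈L₁)

    ∏units≡-cᴺ : ∀ {c y} → y ∈ units → y * y ≡ c [modℤ p ] → ∏ units ≡ - (c ^ N) [modℤ p ]
    ∏units≡-cᴺ {c} {y} y∈ y²≡c = square-case (opposite-unit y∈)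
      where
      square-case : ∃[ y′ ] y′ ∈ units × y′ ≢ y × y′ ≡ - y [modℤ p ] →
                    ∏ units ≡ - (c ^ N) [modℤ p ]
      square-case (y′ , y′∈ , y′≢y , y′≡-y) = ∏units≡-cᴺ′
        where
        L₁ = remove y units
        L₂ = remove y′ L₁
        y′∈L₁ : y′ ∈ L₁
        y′∈L₁ = ∈-remove⁺ y′∈ y′≢y
        yy′≡-c : y * y′ ≡ - c [modℤ p ]
        yy′≡-c = ≡-trans (*-congˡ y y′≡-y)
                   (≡-trans (≡-reflexive (solve 1 (λ y → y :* :- y := :- (y :* y)) refl y)) (-‿cong y²≡c))
        pairing = ∏-paired p-prime (reduced-remove (reduced-remove units-reduced))
                    (paired-off-roots y∈ y′∈ y′≡-y y²≡c)
        k = proj₁ pairing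
        ∏L₂≡cᵏ = proj₂ (proj₂ pairing)
        N≡1+k : N ≡ suc k
        N≡1+k = ℕ.*-cancelˡ-≡ N (suc k) 2 (begin
          2 ℕ.* N                 ≡⟨ length-units ⟨
          length units            ≡⟨ length-remove units-unique y∈ ⟩
          suc (length L₁)         ≡⟨ cong suc (length-remove (remove-unique units-unique) y′∈L₁) ⟩
          suc (suc (length L₂))   ≡⟨ cong (suc ∘ suc) (proj₁ (proj₂ pairing)) ⟩
          suc (suc (2 ℕ.* k))     ≡⟨ ℕ.*-suc 2 k ⟨
          2 ℕ.* suc k             ∎)
          where open ≡-Reasoning
        ∏units≡-cᴺ′ : ∏ units ≡ - (c ^ N) [modℤ p ]
        ∏units≡-cᴺ′ = begin
          ∏ units                ≡⟨ ∏-remove units-unique y∈ ⟩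
          y * ∏ L₁               ≡⟨ cong (y *_) (∏-remove (remove-unique units-unique) y′∈L₁) ⟩
          y * (y′ * ∏ L₂)        ≡⟨ ℤ.*-assoc y y′ (∏ L₂) ⟨
          y * y′ * ∏ L₂          ≈⟨ *-cong yy′≡-c ∏L₂≡cᵏ ⟩
          - c * c ^ k            ≡⟨ ℤ.neg-distribˡ-* c (c ^ k) ⟨
          - (c ^ suc k)          ≡⟨ cong (λ n → - (c ^ n)) N≡1+k ⟨
          - (c ^ N)              ∎
          where open ≡-mod-Reasoning p

    ∏units≡cᴺ : ∀ {c} → ¬ c ≡ 0ℤ [modℤ p ] → (∀ {x} → x ∈ units → ¬ x * x ≡ c [modℤ p ]) →
                ∏ units ≡ c ^ N [modℤ p ]
    ∏units≡cᴺ {c} c≢0 no-root =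
      subst (λ n → ∏ units ≡ c ^ n [modℤ p ]) (sym N≡k) (proj₂ (proj₂ pairing))
      where
      distinct-partner : ∀ {x} → x ∈ units → ∃[ w ] w ∈ units × x * w ≡ c [modℤ p ] →
                         ∃[ w ] w ∈ units × w ≢ x × x * w ≡ c [modℤ p ]
      distinct-partner x∈ (w , w∈ , xw≡c) = w , w∈ , (λ { refl → no-root x∈ xw≡c }) , xw≡c
      pairing = ∏-paired p-prime units-reduced (λ x∈ → distinct-partner x∈ (unit-partner c≢0 x∈))
      N≡k : N ≡ proj₁ pairing
      N≡k = ℕ.*-cancelˡ-≡ N _ 2 (trans (sym length-units) (proj₁ (proj₂ pairing)))

    wilson : ∏ units ≡ -1ℤ [modℤ p ]
    wilson = subst (λ t → ∏ units ≡ - t [modℤ p ]) (ℤ.^-zeroˡ N) (∏units≡-cᴺ (∈-units⁺ 0<2N) ≡-refl)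
      where
      0<2N : 0 ℕ.< 2 ℕ.* N
      0<2N = ℕ.≤-pred 1<p

    euler-square : ∀ {c y} → y ∈ units → y * y ≡ c [modℤ p ] → c ^ N ≡ 1ℤ [modℤ p ]
    euler-square {c} y∈ y²≡c =
      subst₂ _≡_[modℤ p ] (ℤ.neg-involutive (c ^ N)) refl
        (-‿cong (≡-trans (≡-sym (∏units≡-cᴺ y∈ y²≡c)) wilson))

    euler-nonsquare : ∀ {c} → ¬ c ≡ 0ℤ [modℤ p ] → (∀ {x} → x ∈ units → ¬ x * x ≡ c [modℤ p ]) →
                      c ^ N ≡ -1ℤ [modℤ p ]
    euler-nonsquare c≢0 no-root = ≡-trans (≡-sym (∏units≡cᴺ c≢0 no-root)) wilson

    square-residue⇒unit-root : ∀ {x} → ¬ x ≡ 0ℤ [modℤ p ] → ∀ r → r ℕ.* r ℕ.% p ≡ x %ℕ p → r < p →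
                               ∃[ y ] y ∈ units × y * y ≡ x [modℤ p ]
    square-residue⇒unit-root {x} x≢0 zero    r²≡x _ =
      contradiction (≡-trans (≡-%ℕ x p) (≡-reflexive (cong +_ (sym r²≡x)))) x≢0
    square-residue⇒unit-root {x} x≢0 (suc i) r²≡x (s≤s i<2N) = + suc i , ∈-units⁺ i<2N , (begin
      + suc i * + suc i            ≡⟨ ℤ.pos-* (suc i) (suc i) ⟨
      + (suc i ℕ.* suc i)          ≈⟨ ≡-%ℕ (+ (suc i ℕ.* suc i)) p ⟩
      + (suc i ℕ.* suc i ℕ.% p)    ≡⟨ cong +_ r²≡x ⟩
      + (x %ℕ p)                   ≈⟨ ≡-%ℕ x p ⟨
      x                            ∎)
      where open ≡-mod-Reasoning p

    no-square-residue⇒no-unit-root : ∀ {x} → (∀ (y : Fin p) → toℕ y ℕ.* toℕ y ℕ.% p ≢ x %ℕ p) →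
                                     ∀ {z} → z ∈ units → ¬ z * z ≡ x [modℤ p ]
    no-square-residue⇒no-unit-root {x} no-root z∈ = no-root-at (∈-units⁻ z∈)
      where
      no-root-at : ∀ {z} → ∃[ i ] i < 2 ℕ.* N × z ≡ + suc i → ¬ z * z ≡ x [modℤ p ]
      no-root-at (i , i<2N , refl) z²≡x = no-root (fromℕ< (s≤s i<2N))
        (trans (cong (λ t → t ℕ.* t ℕ.% p) (toℕ-fromℕ< (s≤s i<2N)))
               (≡-mod-injective (m%n<n (suc i ℕ.* suc i) p) (n%ℕd<d x p) (begin
                 + (suc i ℕ.* suc i ℕ.% p)   ≈⟨ ≡-%ℕ (+ (suc i ℕ.* suc i)) p ⟨
                 + (suc i ℕ.* suc i)         ≡⟨ ℤ.pos-* (suc i) (suc i) ⟩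
                 + suc i * + suc i           ≈⟨ z²≡x ⟩
                 x                           ≈⟨ ≡-%ℕ x p ⟩
                 + (x %ℕ p)                  ∎)))
        where open ≡-mod-Reasoning p

    legendre-euler : ∀ {x} → ¬ x ≡ 0ℤ [modℤ p ] → legendre x p * x ^ N ≡ 1ℤ [modℤ p ]
    legendre-euler {x} x≢0 = from-view (legendre-view x (2 ℕ.* N))
      where
      from-view : ∀ {l} → LegendreView x (2 ℕ.* N) l → l * x ^ N ≡ 1ℤ [modℤ p ]
      from-view (divisible x%p≡0) = contradiction (≡-trans (≡-%ℕ x p) (≡-reflexive (cong +_ x%p≡0))) x≢0
      from-view (square y y²≡x) =
        let _ , y∈ , y²≡x′ = square-residue⇒unit-root x≢0 (toℕ y) y²≡x (toℕ<n y)
        in ≡-trans (≡-reflexive (ℤ.*-identityˡ (x ^ N))) (euler-square y∈ y²≡x′)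
      from-view (nonsquare no-root) =
        *-congˡ -1ℤ (euler-nonsquare x≢0 (no-square-residue⇒no-unit-root no-root))

    ⟨-m/p⟩mᴺ≡[-1]ᴺ : ∀ {m} → ¬ m ≡ 0ℤ [modℤ p ] → legendre (- m) p * m ^ N ≡ -1ℤ ^ N [modℤ p ]
    ⟨-m/p⟩mᴺ≡[-1]ᴺ {m} m≢0 = *-cancelˡ-≡ p-prime s s≢0 (≡-trans sE≡1 (≡-reflexive (sym s²≡1)))
      where
      s = -1ℤ ^ N
      s²≡1 : s * s ≡ 1ℤ
      s²≡1 = trans ([-1]ⁿ*iⁿ≡[-i]ⁿ -1ℤ N) (ℤ.^-zeroˡ N)
      s≢0 : ¬ s ≡ 0ℤ [modℤ p ]
      s≢0 s≡0 = 0<a<n⇒≢0 (s≤s z≤n) 1<p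
                  (≡-trans (≡-reflexive (sym s²≡1)) (≡-trans (*-congˡ s s≡0) (≡-reflexive (ℤ.*-zeroʳ s))))
      -m≢0 : ¬ - m ≡ 0ℤ [modℤ p ]
      -m≢0 -m≡0 = m≢0 (subst (_≡ 0ℤ [modℤ p ]) (ℤ.neg-involutive m) (-‿cong -m≡0))
      sE≡1 : s * (legendre (- m) p * m ^ N) ≡ 1ℤ [modℤ p ]
      sE≡1 = begin
        s * (legendre (- m) p * m ^ N)   ≡⟨ solve 3 (λ s l x → s :* (l :* x) := l :* (s :* x))
                                                    refl s (legendre (- m) p) (m ^ N) ⟩
        legendre (- m) p * (s * m ^ N)   ≡⟨ cong (legendre (- m) p *_) ([-1]ⁿ*iⁿ≡[-i]ⁿ m N) ⟩
        legendre (- m) p * (- m) ^ N     ≈⟨ legendre-euler -m≢0 ⟩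
        1ℤ                               ∎
        where open ≡-mod-Reasoning p

module BinomialCongruence where

  open import Defs using (legendre; δ)
  open Arithmetic using (coprime-[2n+1]-n)
  open Binomial
  open Congruence
  open QuadraticResidues using (module EulerCriterion)
  open import Data.Nat as ℕ using (ℕ; zero; suc; z≤n; s≤s; _≤_; NonZero)
  import Data.Nat.Properties as ℕ
  open import Data.Nat.Divisibility as ℕ using (_∣_)
  open import Data.Nat.Coprimality using (prime⇒coprime)
  open import Data.Nat.Combinatorics using (_C_; nCk+nC[k+1]≡[n+1]C[k+1])
  open import Data.Nat.Primality using (Prime; prime⇒nonTrivial)
  open import Data.Integer as ℤ using (ℤ; +_; 0ℤ; -1ℤ; _+_; _*_; _-_; -_; _^_)
  import Data.Integer.Properties as ℤ
  open import Relation.Binary.PropositionalEquality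
  open import Relation.Nullary using (¬_; contradiction)
  open import Data.Integer.Solver using (module +-*-Solver)
  open +-*-Solver

  [2n+1]∣[2n+1]Cn : ∀ n → .{{NonZero n}} → suc (2 ℕ.* n) ∣ suc (2 ℕ.* n) C n
  [2n+1]∣[2n+1]Cn (suc k) = coprime⇒[n+1]∣[n+1]C[k+1] (coprime-[2n+1]-n (suc k))

  module _ {n : ℕ} (p-prime : Prime (suc n)) where

    nCk≡[-1]ᵏ : ∀ {k} → k ≤ n → + (n C k) ≡ -1ℤ ^ k [modℤ suc n ]
    nCk≡[-1]ᵏ {zero}  _   = ≡-refl
    nCk≡[-1]ᵏ {suc k} k<n = begin
      + (n C suc k)                   ≡⟨ solve 2 (λ a b → b := (a :+ b) :- a) refl (+ (n C k)) (+ (n C suc k)) ⟩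
      (+ (n C k) + + (n C suc k)) - + (n C k)
                                      ≡⟨ cong (_- + (n C k)) (trans (sym (ℤ.pos-+ (n C k) (n C suc k)))
                                                                    (cong +_ (nCk+nC[k+1]≡[n+1]C[k+1] n k))) ⟩
      + (suc n C suc k) - + (n C k)   ≈⟨ +-cong p∣pC[k+1] (-‿cong (nCk≡[-1]ᵏ (ℕ.<⇒≤ k<n))) ⟩
      0ℤ - -1ℤ ^ k                    ≡⟨ trans (ℤ.+-identityˡ _) (sym (ℤ.-1*i≡-i (-1ℤ ^ k))) ⟩
      -1ℤ ^ suc k                     ∎
      where
      open ≡-mod-Reasoning (suc n)
      p∣pC[k+1] : + (suc n C suc k) ≡ 0ℤ [modℤ suc n ]
      p∣pC[k+1] = ∣⇒≡0 (coprime⇒[n+1]∣[n+1]C[k+1] (prime⇒coprime p-prime (s≤s k<n)))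

  module _ {k : ℕ} (p-prime : Prime (suc (2 ℕ.* suc k))) {m : ℤ}
           (p∤m : ¬ m ≡ 0ℤ [modℤ suc (2 ℕ.* suc k) ]) where

    private
      N = suc k
      p = suc (2 ℕ.* N)
      open EulerCriterion N p-prime using (⟨-m/p⟩mᴺ≡[-1]ᴺ)

    [2N+1]CN≡2p⟨-m/p⟩mᴺ : + (p C N) ≡ + 2 * + p * legendre (- m) p * m ^ N [modℤ p ℕ.^ 2 ]
    [2N+1]CN≡2p⟨-m/p⟩mᴺ = subst (+ (p C N) ≡ + 2 * + p * legendre (- m) p * m ^ N [modℤ_])
                                (cong (p ℕ.*_) (sym (ℕ.*-identityʳ p)))
                                (subst₂ _≡_[modℤ p ℕ.* p ] pt≡pCN p[2E]≡2pEᴺ (*-scale p t≡2E))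
      where
      p∣pCN : p ∣ p C N
      p∣pCN = [2n+1]∣[2n+1]Cn N
      t′ = ℕ.quotient p∣pCN
      pCN≡t′p : p C N ≡ t′ ℕ.* p
      pCN≡t′p = ℕ._∣_.equality p∣pCN
      s E t : ℤ
      s = -1ℤ ^ N
      E = legendre (- m) p * m ^ N
      t = + t′

      pt≡pCN : + p * t ≡ + (p C N)
      pt≡pCN = trans (sym (ℤ.pos-* p t′)) (cong +_ (trans (ℕ.*-comm p t′) (sym pCN≡t′p)))

      p[2E]≡2pEᴺ : + p * (+ 2 * E) ≡ + 2 * + p * legendre (- m) p * m ^ N
      p[2E]≡2pEᴺ = solve 3 (λ P l x → P :* (con (+ 2) :* (l :* x)) := con (+ 2) :* P :* l :* x) refl
                     (+ p) (legendre (- m) p) (m ^ N)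

      Nt′≡2NCk : N ℕ.* t′ ≡ 2 ℕ.* N C k
      Nt′≡2NCk = ℕ.*-cancelʳ-≡ (N ℕ.* t′) (2 ℕ.* N C k) p (begin
        N ℕ.* t′ ℕ.* p         ≡⟨ ℕ.*-assoc N t′ p ⟩
        N ℕ.* (t′ ℕ.* p)       ≡⟨ cong (N ℕ.*_) pCN≡t′p ⟨
        N ℕ.* (p C N)          ≡⟨ [k+1]*[n+1]C[k+1]≡[n+1]*nCk (2 ℕ.* N) k ⟩
        p ℕ.* (2 ℕ.* N C k)    ≡⟨ ℕ.*-comm p (2 ℕ.* N C k) ⟩
        (2 ℕ.* N C k) ℕ.* p    ∎)
        where open ≡-Reasoning

      Nt≡-s : + N * t ≡ - s [modℤ p ]
      Nt≡-s = begin
        + N * t                ≡⟨ ℤ.pos-* N t′ ⟨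
        + (N ℕ.* t′)           ≡⟨ cong +_ Nt′≡2NCk ⟩
        + (2 ℕ.* N C k)        ≈⟨ nCk≡[-1]ᵏ p-prime (ℕ.≤-trans (ℕ.n≤1+n k) (ℕ.m≤m+n N _)) ⟩
        -1ℤ ^ k                ≡⟨ solve 1 (λ x → x := :- (con -1ℤ :* x)) refl (-1ℤ ^ k) ⟩
        - s                    ∎
        where open ≡-mod-Reasoning p

      2N≡-1 : + (2 ℕ.* N) ≡ -1ℤ [modℤ p ]
      2N≡-1 = begin
        + (2 ℕ.* N)            ≡⟨⟩
        -1ℤ + + p              ≈⟨ +-cong (≡-refl {a = -1ℤ}) n≡0 ⟩
        -1ℤ + 0ℤ               ≡⟨⟩
        -1ℤ                    ∎
        where open ≡-mod-Reasoning p

      N[2E]≡-E : + N * (+ 2 * E) ≡ - E [modℤ p ]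
      N[2E]≡-E = begin
        + N * (+ 2 * E)        ≡⟨ solve 2 (λ n e → n :* (con (+ 2) :* e) := (con (+ 2) :* n) :* e) refl (+ N) E ⟩
        + 2 * + N * E          ≡⟨ cong (_* E) (ℤ.pos-* 2 N) ⟨
        + (2 ℕ.* N) * E        ≈⟨ *-congʳ E 2N≡-1 ⟩
        -1ℤ * E                ≡⟨ ℤ.-1*i≡-i E ⟩
        - E                    ∎
        where open ≡-mod-Reasoning p

      t≡2E : t ≡ + 2 * E [modℤ p ]
      t≡2E = *-cancelˡ-≡ p-prime (+ N) (0<a<n⇒≢0 (s≤s z≤n) (s≤s (ℕ.m≤m+n N _)))
        (≡-trans Nt≡-s (≡-trans (-‿cong (≡-sym (⟨-m/p⟩mᴺ≡[-1]ᴺ p∤m))) (≡-sym N[2E]≡-E)))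

  prime-power-∣[2N+1]CN : ∀ {p b N} → Prime p → p ℕ.^ suc (suc b) ≡ suc (2 ℕ.* N) →
                          p ℕ.^ 2 ∣ suc (2 ℕ.* N) C N
  prime-power-∣[2N+1]CN {p} {b} {zero}  p-prime P≡1 =
    contradiction (ℕ.∣1⇒≡1 (subst (p ∣_) P≡1 (ℕ.m∣m*n (p ℕ.^ suc b))))
                  (ℕ.nonTrivial⇒≢1 ⦃ prime⇒nonTrivial p-prime ⦄)
  prime-power-∣[2N+1]CN {p} {b} {suc k} p-prime P≡2N+1 =
    ℕ.∣-trans (subst (p ℕ.^ 2 ∣_) P≡2N+1 p²∣P) ([2n+1]∣[2n+1]Cn (suc k))
    where
    p²∣P : p ℕ.^ 2 ∣ p ℕ.^ suc (suc b)
    p²∣P = ℕ.*-monoʳ-∣ p (ℕ.*-monoʳ-∣ p (ℕ.1∣ (p ℕ.^ b)))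

  binomial-congruence : ∀ {p a N m} → Prime p → 1 ≤ a → p ℕ.^ a ≡ suc (2 ℕ.* N) → ¬ m ≡ 0ℤ [modℤ p ] →
    + (suc (2 ℕ.* N) C N) ≡ + 2 * + p * δ a 1 * legendre (- m) p * m ^ N [modℤ p ℕ.^ 2 ]
  binomial-congruence {p} {1} {zero} p-prime _ p*1≡1 _ =
    contradiction (trans (sym (ℕ.*-identityʳ p)) p*1≡1) (ℕ.nonTrivial⇒≢1 ⦃ prime⇒nonTrivial p-prime ⦄)
  binomial-congruence {p} {1} {suc k} {m} p-prime _ p*1≡2N+1 p∤m
    with refl ← trans (sym (ℕ.*-identityʳ p)) p*1≡2N+1 =
    subst (λ r → + (p C suc k) ≡ r [modℤ p ℕ.^ 2 ])
          (cong (λ t → t * legendre (- m) p * m ^ suc k) (sym (ℤ.*-identityʳ (+ 2 * + p))))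
          ([2N+1]CN≡2p⟨-m/p⟩mᴺ p-prime p∤m)
  binomial-congruence {p} {suc (suc b)} {N} {m} p-prime _ P≡2N+1 _ =
    ≡-trans (∣⇒≡0 (prime-power-∣[2N+1]CN {b = b} {N} p-prime P≡2N+1))
            (≡-reflexive (cong (λ t → t * legendre (- m) p * m ^ N) (sym (ℤ.*-zeroʳ (+ 2 * + p)))))

module CentralBinomialSums where

  open import Defs
  open Congruence using (_≡_[modℤ_]; ≡0⇒∣; ≡⇒-≡0)
  open Binomial
  open import Data.Nat.Combinatorics using (_C_)
  open import Data.Nat as ℕ using (ℕ; zero; suc)
  open import Data.Integer as ℤ using (ℤ; +_; -[1+_]; 0ℤ; _^_)
  import Data.Integer.Properties as ℤ
  open import Data.Rational using (ℚ; mkℚ; -_; ↥_; ↧ₙ_; 1ℚ; 0ℚ; _+_; _*_; _-_; ½; fromℚᵘ; toℚᵘ)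
  open import Data.Rational.Properties
    using ( toℚᵘ-cong; toℚᵘ-injective; toℚᵘ-fromℚᵘ; fromℚᵘ-cong
          ; toℚᵘ-homo-*; toℚᵘ-homo-+; toℚᵘ-homo‿-
          ; +-identityˡ; +-identityʳ; +-assoc; *-identityʳ)
  import Data.Rational.Unnormalised as U
  import Data.Rational.Unnormalised.Properties as U
  open import Data.List using (foldr; map; applyUpTo)
  open import Data.Empty using (⊥-elim)
  open import Function using (id; _∘_)
  open import Relation.Binary.PropositionalEquality
  open import Data.Nat.Coprimality as Coprimality using (Coprime; coprime-divisor)
  import Data.Nat.Divisibility as ℕ
  import Data.Nat.Properties as ℕ
  open import Data.Nat.Divisibility using (divides)
  open import Data.Integer.Divisibility using () renaming (_∣_ to _∣ℤ_)
  open import Data.Product using (_×_; _,_)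
  import Data.Rational.Solver as ℚ-Solver

  fromℚᵘ-homo-* : ∀ p q → fromℚᵘ (p U.* q) ≡ fromℚᵘ p * fromℚᵘ q
  fromℚᵘ-homo-* p q = toℚᵘ-injective (begin
    toℚᵘ (fromℚᵘ (p U.* q))                ≈⟨ toℚᵘ-fromℚᵘ (p U.* q) ⟩
    p U.* q                                ≈⟨ U.*-cong (toℚᵘ-fromℚᵘ p) (toℚᵘ-fromℚᵘ q) ⟨
    toℚᵘ (fromℚᵘ p) U.* toℚᵘ (fromℚᵘ q)    ≈⟨ toℚᵘ-homo-* (fromℚᵘ p) (fromℚᵘ q) ⟨
    toℚᵘ (fromℚᵘ p * fromℚᵘ q)             ∎)
    where open U.≃-Reasoning

  fromℚᵘ-homo-+ : ∀ p q → fromℚᵘ (p U.+ q) ≡ fromℚᵘ p + fromℚᵘ q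
  fromℚᵘ-homo-+ p q = toℚᵘ-injective (begin
    toℚᵘ (fromℚᵘ (p U.+ q))                ≈⟨ toℚᵘ-fromℚᵘ (p U.+ q) ⟩
    p U.+ q                                ≈⟨ U.+-cong (toℚᵘ-fromℚᵘ p) (toℚᵘ-fromℚᵘ q) ⟨
    toℚᵘ (fromℚᵘ p) U.+ toℚᵘ (fromℚᵘ q)    ≈⟨ toℚᵘ-homo-+ (fromℚᵘ p) (fromℚᵘ q) ⟨
    toℚᵘ (fromℚᵘ p + fromℚᵘ q)             ∎)
    where open U.≃-Reasoning

  -- ℤ→ℚ z is definitionally fromℚᵘ (z / 1), and for z ≢ 0 recipℤ z is definitionally fromℚᵘ (1/ (z / 1)).
  ℤ→ℚ-homo-* : ∀ a b → ℤ→ℚ (a ℤ.* b) ≡ ℤ→ℚ a * ℤ→ℚ b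
  ℤ→ℚ-homo-* a b = fromℚᵘ-homo-* (a U./ 1) (b U./ 1)

  ℤ→ℚ-homo-+ : ∀ a b → ℤ→ℚ (a ℤ.+ b) ≡ ℤ→ℚ a + ℤ→ℚ b
  ℤ→ℚ-homo-+ a b =
    trans (fromℚᵘ-cong {(a ℤ.+ b) U./ 1} {a U./ 1 U.+ b U./ 1} (U.*≡* (cong (ℤ._* + 1) denominators-cleared)))
          (fromℚᵘ-homo-+ (a U./ 1) (b U./ 1))
    where
    denominators-cleared : a ℤ.+ b ≡ a ℤ.* + 1 ℤ.+ b ℤ.* + 1
    denominators-cleared = sym (cong₂ ℤ._+_ (ℤ.*-identityʳ a) (ℤ.*-identityʳ b))

  fromℚᵘ-homo‿- : ∀ p → fromℚᵘ (U.- p) ≡ - fromℚᵘ p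
  fromℚᵘ-homo‿- p = toℚᵘ-injective (begin
    toℚᵘ (fromℚᵘ (U.- p))    ≈⟨ toℚᵘ-fromℚᵘ (U.- p) ⟩
    U.- p                    ≈⟨ U.-‿cong (toℚᵘ-fromℚᵘ p) ⟨
    U.- toℚᵘ (fromℚᵘ p)      ≈⟨ toℚᵘ-homo‿- (fromℚᵘ p) ⟨
    toℚᵘ (- fromℚᵘ p)        ∎)
    where open U.≃-Reasoning

  ℤ→ℚ-homo-- : ∀ a b → ℤ→ℚ (a ℤ.- b) ≡ ℤ→ℚ a - ℤ→ℚ b
  ℤ→ℚ-homo-- a b = trans (ℤ→ℚ-homo-+ a (ℤ.- b)) (cong (λ t → ℤ→ℚ a + t) (fromℚᵘ-homo‿- (b U./ 1)))

  fromℚᵘ-1/-inverseˡ : ∀ p .{{_ : U.NonZero p}} → fromℚᵘ (U.1/ p) * fromℚᵘ p ≡ 1ℚ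
  fromℚᵘ-1/-inverseˡ p = trans (sym (fromℚᵘ-homo-* (U.1/ p) p)) (fromℚᵘ-cong (U.*-inverseˡ p))

  recipℤ-inverseˡ : ∀ {z} → z ≢ 0ℤ → recipℤ z * ℤ→ℚ z ≡ 1ℚ
  recipℤ-inverseˡ {+ zero}   z≢0 = ⊥-elim (z≢0 refl)
  recipℤ-inverseˡ {+ suc n}  _   = fromℚᵘ-1/-inverseˡ (+ suc n U./ 1)
  recipℤ-inverseˡ { -[1+ n ]} _   = fromℚᵘ-1/-inverseˡ (-[1+ n ] U./ 1)

  Σ[0…]-suc : ∀ (f : ℕ → ℚ) N → Σ[0… suc N ] f ≡ Σ[0… N ] f + f (suc N)
  Σ[0…]-suc f N = foldr-applyUpTo-suc id (suc N)
    where
    foldr-applyUpTo-suc : ∀ g n → foldr _+_ 0ℚ (map f (applyUpTo g (suc n)))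
                                  ≡ foldr _+_ 0ℚ (map f (applyUpTo g n)) + f (g n)
    foldr-applyUpTo-suc g zero    = trans (+-identityʳ (f (g 0))) (sym (+-identityˡ (f (g 0))))
    foldr-applyUpTo-suc g (suc n) = trans (cong (λ s → f (g 0) + s) (foldr-applyUpTo-suc (g ∘ suc) n))
                                          (sym (+-assoc (f (g 0)) _ _))

  recipℤ-^-suc : ∀ {m} → m ≢ 0ℤ → ∀ k → recipℤ (m ^ k) ≡ ℤ→ℚ m * recipℤ (m ^ suc k)
  recipℤ-^-suc {m} m≢0 k = begin
    r                      ≡⟨ *-identityʳ r ⟨
    r * 1ℚ                 ≡⟨ cong (r *_) (recipℤ-inverseˡ (m^≢0 (suc k))) ⟨
    r * (r′ * ℤ→ℚ (m ^ suc k)) ≡⟨ cong (λ t → r * (r′ * t)) (ℤ→ℚ-homo-* m (m ^ k)) ⟩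
    r * (r′ * (M * X))     ≡⟨ solve 4 (λ r r′ M X → r :* (r′ :* (M :* X)) := (M :* r′) :* (r :* X))
                                   refl r r′ M X ⟩
    (M * r′) * (r * X)     ≡⟨ cong ((M * r′) *_) (recipℤ-inverseˡ (m^≢0 k)) ⟩
    (M * r′) * 1ℚ          ≡⟨ *-identityʳ (M * r′) ⟩
    M * r′                 ∎
    where
    open ≡-Reasoning
    open ℚ-Solver.+-*-Solver
    m^≢0 : ∀ j → m ^ j ≢ 0ℤ
    m^≢0 j = m≢0 ∘ ℤ.i^n≡0⇒i≡0 m j
    r = recipℤ (m ^ k)
    r′ = recipℤ (m ^ suc k)
    M = ℤ→ℚ m
    X = ℤ→ℚ (m ^ k)

  module _ {m : ℤ} (m≢0 : m ≢ 0ℤ) where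

    private
      M two : ℚ
      M = ℤ→ℚ m
      two = ℤ→ℚ (+ 2)

      ℚ[_C_] : ℕ → ℕ → ℚ
      ℚ[ n C k ] = ℤ→ℚ (+ (n C k))

      r : ℕ → ℚ
      r k = recipℤ (m ^ k)

    Σ[2kCk+1/mᵏ]≡ : ∀ N →
      Σ[0… N ] (λ k → ℚ[ 2 ℕ.* k C suc k ] * r k)
        ≡ ((M - two) * ½) * Σ[0… N ] (λ k → ℚ[ 2 ℕ.* k C k ] * r k) - M * ½
          + ℚ[ suc (2 ℕ.* N) C N ] * r N
    Σ[2kCk+1/mᵏ]≡ zero    =
      solve 1 (λ M → con 0ℚ := ((M :- con two) :* con ½) :* con 1ℚ :- M :* con ½ :+ con 1ℚ) refl M
      where open ℚ-Solver.+-*-Solver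
    Σ[2kCk+1/mᵏ]≡ (suc N) = begin
      Σ[0… suc N ] L                           ≡⟨ Σ[0…]-suc L N ⟩
      Σ[0… N ] L + A * r′                      ≡⟨ cong (_+ A * r′) (Σ[2kCk+1/mᵏ]≡ N) ⟩
      K * S - M * ½ + c * r N + A * r′         ≡⟨ cong (λ t → K * S - M * ½ + c * t + A * r′) (recipℤ-^-suc m≢0 N) ⟩
      -- the term c·r′ cancels because 2·(m - 2)/2 + 2 = m
      K * S - M * ½ + c * (M * r′) + A * r′    ≡⟨ solve 5 (λ M S c A r′ →
          ((M :- con two) :* con ½) :* S :- M :* con ½ :+ c :* (M :* r′) :+ A :* r′
            := ((M :- con two) :* con ½) :* (S :+ (con two :* c) :* r′) :- M :* con ½ :+ (A :+ con two :* c) :* r′)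
          refl M S c A r′ ⟩
      K * (S + (two * c) * r′) - M * ½ + (A + two * c) * r′
          ≡⟨ cong₂ (λ u v → K * (S + u * r′) - M * ½ + v * r′) (sym B≡2c) (sym c′≡A+2c) ⟩
      K * (S + B * r′) - M * ½ + c′ * r′       ≡⟨ cong (λ t → K * t - M * ½ + c′ * r′) (Σ[0…]-suc Sf N) ⟨
      K * Σ[0… suc N ] Sf - M * ½ + c′ * r′    ∎
      where
      open ≡-Reasoning
      open ℚ-Solver.+-*-Solver
      L Sf : ℕ → ℚ
      L k = ℚ[ 2 ℕ.* k C suc k ] * r k
      Sf k = ℚ[ 2 ℕ.* k C k ] * r k
      K = (M - two) * ½
      S = Σ[0… N ] Sf
      r′ = r (suc N)
      A = ℚ[ 2 ℕ.* suc N C suc (suc N) ]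
      B = ℚ[ 2 ℕ.* suc N C suc N ]
      c = ℚ[ suc (2 ℕ.* N) C N ]
      c′ = ℚ[ suc (2 ℕ.* suc N) C suc N ]
      B≡2c : B ≡ two * c
      B≡2c = trans (cong ℤ→ℚ (trans (cong +_ ([2n+2]C[n+1]≡2*[2n+1]Cn N)) (ℤ.pos-* 2 c₀)))
                   (ℤ→ℚ-homo-* (+ 2) (+ c₀))
        where c₀ = suc (2 ℕ.* N) C N
      c′≡A+2c : c′ ≡ A + two * c
      c′≡A+2c = trans (cong ℤ→ℚ (trans (cong +_ ([2n+3]C[n+1]≡[2n+2]C[n+2]+[2n+2]C[n+1] N))
                                      (ℤ.pos-+ a b)))
                      (trans (ℤ→ℚ-homo-+ (+ a) (+ b)) (cong (λ t → A + t) B≡2c))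
        where
        a = 2 ℕ.* suc N C suc (suc N)
        b = 2 ℕ.* suc N C suc N

  module _ {n : ℕ} {D Z : ℤ} (coprime : Coprime ℤ.∣ D ∣ n) (n∣Z : n ℕ.∣ ℤ.∣ Z ∣) where

    private
      numerator-divisible : ∀ q → q * ℤ→ℚ D ≡ ℤ→ℚ Z → Coprime (↧ₙ q) n × (+ n) ∣ℤ (↥ q)
      numerator-divisible q@(mkℚ a d-1 a⊥d) qD≡Z = d⊥n , n∣a
        where
        d = suc d-1
        qD≃Z : U.mkℚᵘ a d-1 U.* (D U./ 1) U.≃ Z U./ 1
        qD≃Z = U.≃-trans (U.*-congˡ {U.mkℚᵘ a d-1} (U.≃-sym (toℚᵘ-fromℚᵘ (D U./ 1))))
               (U.≃-trans (U.≃-sym (toℚᵘ-homo-* q (ℤ→ℚ D)))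
               (U.≃-trans (toℚᵘ-cong qD≡Z) (toℚᵘ-fromℚᵘ (Z U./ 1))))
        aD≡Zd : ℤ.∣ a ∣ ℕ.* ℤ.∣ D ∣ ≡ ℤ.∣ Z ∣ ℕ.* d
        aD≡Zd with U.*≡* eq ← qD≃Z = begin
          ℤ.∣ a ∣ ℕ.* ℤ.∣ D ∣          ≡⟨ ℤ.abs-* a D ⟨
          ℤ.∣ a ℤ.* D ∣                ≡⟨ cong ℤ.∣_∣ (ℤ.*-identityʳ (a ℤ.* D)) ⟨
          ℤ.∣ a ℤ.* D ℤ.* + 1 ∣        ≡⟨ cong ℤ.∣_∣ eq ⟩
          ℤ.∣ Z ℤ.* + (d ℕ.* 1) ∣      ≡⟨ ℤ.abs-* Z (+ (d ℕ.* 1)) ⟩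
          ℤ.∣ Z ∣ ℕ.* (d ℕ.* 1)        ≡⟨ cong (ℤ.∣ Z ∣ ℕ.*_) (ℕ.*-identityʳ d) ⟩
          ℤ.∣ Z ∣ ℕ.* d                ∎
          where open ≡-Reasoning
        d∣D : d ℕ.∣ ℤ.∣ D ∣
        d∣D = coprime-divisor (Coprimality.sym (Coprimality.recompute a⊥d)) (divides ℤ.∣ Z ∣ aD≡Zd)
        d⊥n : Coprime d n
        d⊥n (e∣d , e∣n) = coprime (ℕ.∣-trans e∣d d∣D , e∣n)
        n∣a : n ℕ.∣ ℤ.∣ a ∣
        n∣a = coprime-divisor (Coprimality.sym coprime)
                (subst (n ℕ.∣_) (trans (sym aD≡Zd) (ℕ.*-comm ℤ.∣ a ∣ ℤ.∣ D ∣))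
                       (ℕ.∣-trans n∣Z (ℕ.m∣m*n d)))

    ≡[modℚ]-by-clearing : ∀ x y → (x - y) * ℤ→ℚ D ≡ ℤ→ℚ Z → x ≡ y [modℚ n ]
    ≡[modℚ]-by-clearing x y = numerator-divisible (x - y)

  module _ {m : ℤ} (m≢0 : m ≢ 0ℤ) {N n : ℕ} (coprime : Coprime ℤ.∣ m ^ N ∣ n) where

    Σ[2kCk+1/mᵏ]-congruence : ∀ T → (+ (suc (2 ℕ.* N) C N)) ≡ T ℤ.* m ^ N [modℤ n ] →
      Σ[0… N ] (λ k → ℤ→ℚ (+ (2 ℕ.* k C suc k)) * recipℤ (m ^ k))
        ≡ ((ℤ→ℚ m - ℤ→ℚ (+ 2)) * ½) * Σ[0… N ] (λ k → ℤ→ℚ (+ (2 ℕ.* k C k)) * recipℤ (m ^ k))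
          - ℤ→ℚ m * ½
          + ℤ→ℚ T
        [modℚ n ]
    Σ[2kCk+1/mᵏ]-congruence T c≡Tmᴺ =
      ≡[modℚ]-by-clearing {D = m ^ N} {Z} coprime (≡0⇒∣ (≡⇒-≡0 c≡Tmᴺ)) L (R + ℤ→ℚ T) (begin
        (L - (R + ℤ→ℚ T)) * X         ≡⟨ cong (λ t → (t - (R + ℤ→ℚ T)) * X) (Σ[2kCk+1/mᵏ]≡ m≢0 N) ⟩
        ((R + c * r) - (R + ℤ→ℚ T)) * X
                                      ≡⟨ solve 5 (λ R c r t X → ((R :+ c :* r) :- (R :+ t)) :* X := c :* (r :* X) :- t :* X)
                                                 refl R c r (ℤ→ℚ T) X ⟩
        c * (r * X) - ℤ→ℚ T * X       ≡⟨ cong (λ u → c * u - ℤ→ℚ T * X) (recipℤ-inverseˡ mᴺ≢0) ⟩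
        c * 1ℚ - ℤ→ℚ T * X            ≡⟨ cong₂ _-_ (*-identityʳ c) (sym (ℤ→ℚ-homo-* T (m ^ N))) ⟩
        c - ℤ→ℚ (T ℤ.* m ^ N)         ≡⟨ ℤ→ℚ-homo-- (+ (suc (2 ℕ.* N) C N)) (T ℤ.* m ^ N) ⟨
        ℤ→ℚ Z                         ∎)
      where
      open ≡-Reasoning
      open ℚ-Solver.+-*-Solver
      Z = + (suc (2 ℕ.* N) C N) ℤ.- T ℤ.* m ^ N
      L = Σ[0… N ] (λ k → ℤ→ℚ (+ (2 ℕ.* k C suc k)) * recipℤ (m ^ k))
      R = ((ℤ→ℚ m - ℤ→ℚ (+ 2)) * ½) * Σ[0… N ] (λ k → ℤ→ℚ (+ (2 ℕ.* k C k)) * recipℤ (m ^ k))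
            - ℤ→ℚ m * ½
      c = ℤ→ℚ (+ (suc (2 ℕ.* N) C N))
      r = recipℤ (m ^ N)
      X = ℤ→ℚ (m ^ N)
      mᴺ≢0 : m ^ N ≢ 0ℤ
      mᴺ≢0 = m≢0 ∘ ℤ.i^n≡0⇒i≡0 m N

open import Defs
open import Data.Nat using (ℕ; suc; _≤_; _∸_; _^_) renaming (_/_ to _/ℕ_; _*_ to _*ℕ_)
open import Data.Nat.Combinatorics using (_C_)
open import Data.Nat.Primality using (Prime)
open import Data.Integer using (ℤ; +_; -_) renaming (_^_ to _^ℤ_; _*_ to _*ℤ_)
open import Data.Integer.Divisibility using () renaming (_∣_ to _∣ℤ_)
open import Data.Rational using (ℚ; ½; _+_; _-_; _*_)
open import Relation.Binary.PropositionalEquality using (_≡_)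
open import Relation.Nullary using (¬_)
open import Data.Nat.Divisibility using (_∣0)
open import Data.Nat.Coprimality as Coprimality using (Coprime)
import Data.Integer as ℤ
open import Function.Base using (_∘_)
open import Relation.Binary.PropositionalEquality using (_≢_; refl; sym; subst)
open Arithmetic
open Congruence using (≡0⇒∣)
open BinomialCongruence using (binomial-congruence)
open CentralBinomialSums using (Σ[2kCk+1/mᵏ]-congruence)

lemma3p3 : (p a : ℕ) → (m : ℤ) → Prime p → ¬ (p ≡ 2) → 1 ≤ a → ¬ ((+ p) ∣ℤ m) →
  (Σ[0… (p ^ a ∸ 1) /ℕ 2 ] (λ k → ℤ→ℚ (+ ((2 *ℕ k) C (suc k))) * recipℤ (m ^ℤ k)))
    ≡ ((ℤ→ℚ m - ℤ→ℚ (+ 2)) * ½) * Σ[0… (p ^ a ∸ 1) /ℕ 2 ] (λ k → ℤ→ℚ (+ ((2 *ℕ k) C k)) * recipℤ (m ^ℤ k))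
      - ℤ→ℚ m * ½
      + ℤ→ℚ ((+ 2) *ℤ (+ p) *ℤ δ a 1 *ℤ legendre (- m) p)
    [modℚ p ^ 2 ]
lemma3p3 p a m p-prime p≢2 1≤a p∤m =
  Σ[2kCk+1/mᵏ]-congruence m≢0 {N} mᴺ⊥p² ((+ 2) *ℤ (+ p) *ℤ δ a 1 *ℤ legendre (- m) p)
    (binomial-congruence {N = N} {m} p-prime 1≤a pᵃ≡2N+1 (p∤m ∘ ≡0⇒∣))
  where
  N = (p ^ a ∸ 1) /ℕ 2
  pᵃ≡2N+1 : p ^ a ≡ suc (2 *ℕ N)
  pᵃ≡2N+1 = %2≡1⇒≡1+2*[[n∸1]/2] (^-%2≡1 (prime≢2⇒%2≡1 p-prime p≢2) a)
  m≢0 : m ≢ ℤ.0ℤ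
  m≢0 refl = p∤m (p ∣0)
  mᴺ⊥p² : Coprime ℤ.∣ m ^ℤ N ∣ (p ^ 2)
  mᴺ⊥p² = subst (λ x → Coprime x (p ^ 2)) (sym (∣i^n∣≡∣i∣^n m N))
            (coprime-^ˡ N (Coprimality.sym (coprime-^ˡ 2 (prime∤⇒coprime p-prime p∤m))))
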